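{- Let $f:\mathbb{N}\to\mathbb{N}$ be any function. For each $d\in\mathbb{N}$, there exists a $(k(d),\varepsilon(d))$-secluded unit cube partition of $\mathbb{R}^d$, where $k(d)=(f(d)+1)^{\lceil d/f(d)\rceil}$ and $\varepsilon(d)=\frac{1}{2f(d)}$.
   Context: A partition $\mathcal{P}$ of $\mathbb{R}^d$ is $(k,\varepsilon)$-secluded if for every $\vec{p}\in\mathbb{R}^d$ the closed $\ell_\infty$ ball $\{\vec{x}:\|\vec{x}-\vec{p}\|_\infty\le\varepsilon\}$ intersects at most $k$ members of $\mathcal{P}$. A unit cube partition is a partition of $\mathbb{R}^d$ each of whose members is a unit cube, i.e., a product $\prod_{i=1}^d [a_i,a_i+1)$ of translates of $[0,1)$. -}

module Defs where

open import Level using (0ℓ)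
open import Data.Nat as ℕ using (ℕ; zero; suc; _^_; _∸_)
open import Data.Nat.DivMod using (_/_)
open import Data.Fin using (Fin)
open import Data.Product using (Σ; ∃; _×_; _,_)
open import Data.Sum using (_⊎_)
open import Data.List using (List; length)
open import Data.List.Relation.Unary.All using (All)
open import Data.List.Relation.Unary.AllPairs using (AllPairs)
open import Relation.Binary.PropositionalEquality using (_≡_; _≢_)
open import Relation.Nullary using (¬_)

-- ceiling of n / m for m ≥ 1 (value at m = 0 is irrelevant, set to 0)
ceilDiv : ℕ → ℕ → ℕ
ceilDiv n zero    = 0
ceilDiv n (suc m) = (n ℕ.+ m) / suc m

-- The real numbers, axiomatised as a complete ordered field
-- (every model is isomorphic to ℝ; stdlib has no reals).
record RealField : Set₁ where
  infixl 6 _+_ _-_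
  infixl 7 _*_
  infix 4 _≤_ _<_
  field
    R    : Set
    0r 1r : R
    _+_ _*_ : R → R → R
    -_   : R → R
    _≤_  : R → R → Set
    +-assoc    : ∀ x y z → (x + y) + z ≡ x + (y + z)
    +-comm     : ∀ x y → x + y ≡ y + x
    +-identity : ∀ x → x + 0r ≡ x
    +-inverse  : ∀ x → x + (- x) ≡ 0r
    *-assoc    : ∀ x y z → (x * y) * z ≡ x * (y * z)
    *-comm     : ∀ x y → x * y ≡ y * x
    *-identity : ∀ x → x * 1r ≡ x
    distrib    : ∀ x y z → x * (y + z) ≡ x * y + x * z
    0≢1        : 0r ≢ 1r
    *-inverse  : ∀ x → x ≢ 0r → ∃ λ y → x * y ≡ 1r
    ≤-refl     : ∀ x → x ≤ x
    ≤-antisym  : ∀ {x y} → x ≤ y → y ≤ x → x ≡ y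
    ≤-trans    : ∀ {x y z} → x ≤ y → y ≤ z → x ≤ z
    ≤-total    : ∀ x y → x ≤ y ⊎ y ≤ x
    +-mono-≤   : ∀ {x y} z → x ≤ y → x + z ≤ y + z
    *-nonneg   : ∀ {x y} → 0r ≤ x → 0r ≤ y → 0r ≤ x * y
    sup : (S : R → Set) → (∃ λ x → S x) → (∃ λ b → ∀ x → S x → x ≤ b) →
          ∃ λ s → (∀ x → S x → x ≤ s) × (∀ b → (∀ x → S x → x ≤ b) → s ≤ b)

  _-_ : R → R → R
  x - y = x + (- y)

  _<_ : R → R → Set
  x < y = x ≤ y × x ≢ y

  fromℕ : ℕ → R
  fromℕ zero    = 0r
  fromℕ (suc n) = 1r + fromℕ n

module _ (ℝ : RealField) where
  open RealField ℝ

  Point : ℕ → Set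
  Point d = Fin d → R

  InCube : ∀ {d} → Point d → Point d → Set
  InCube {d} a x = ∀ (i : Fin d) → a i ≤ x i × x i < a i + 1r

  DistinctCube : ∀ {d} → Point d → Point d → Set
  DistinctCube {d} a b = ¬ (∀ (i : Fin d) → a i ≡ b i)

  IsUnitCubePartition : ∀ {d} → (Point d → Set) → Set
  IsUnitCubePartition {d} C =
    (∀ (x : Point d) → ∃ λ a → C a × InCube a x) ×
    (∀ (x a b : Point d) → C a → C b → InCube a x → InCube b x →
       ∀ (i : Fin d) → a i ≡ b i)

  BallMeetsCube : ∀ {d} → R → Point d → Point d → Set
  BallMeetsCube {d} ε p a = ∃ λ (x : Point d) → InCube a x ×
    (∀ (i : Fin d) → p i - ε ≤ x i × x i ≤ p i + ε)

  -- (k, ε)-secluded: every closed ε-ball meets at most k members,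
  -- i.e. any list of pairwise distinct members meeting the ball has length ≤ k
  Secluded : ∀ {d} → ℕ → R → (Point d → Set) → Set
  Secluded {d} k ε C = ∀ (p : Point d) (L : List (Point d)) →
    All C L → All (BallMeetsCube ε p) L → AllPairs DistinctCube L →
    length L ℕ.≤ k

-- Let F = f d and group the coordinates into consecutive blocks of F. The cube containing x
-- is found coordinate by coordinate: coordinate p is shifted by w = 1/F times the sum of the
-- floors already taken in its block, floored, and shifted back. Corners therefore lie in
-- (1/F)ℤ, and F times a corner coordinate is an integer "level". A ball of radius 1/(2F)
-- around p only meets cubes whose levels lie in a window [G − F, G] determined by p, and
-- two such cubes coincide as soon as their levels agree at the last coordinate of every
-- block, since a difference between their floors is carried along by the shifts and cannot
-- cancel before the block ends. So a met cube is fixed by F + 1 choices per block.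
-- Over the axiomatised reals, floor is built as a supremum and integer witnesses exist only
-- under double negation; this suffices because the seclusion bound is decidable.

module Submission where

open import Defs
open import Level using (0ℓ)
open import Function using (case_of_)
open import Data.Nat as ℕ using (ℕ; zero; suc; z≤n; s≤s; _^_)
import Data.Nat.Properties as ℕP
open import Data.Nat.DivMod using (_/_; _%_; m*n/n≡m; /-monoˡ-≤; [m+kn]%n≡m%n; m<n⇒m%n≡m)
open import Data.Integer as ℤ using (ℤ; -[1+_]; +0; +[1+_]; sign; ∣_∣; _◃_; _⊖_)
import Data.Integer.Properties as ℤP
open import Data.Integer.Tactic.RingSolver using (solve-∀)
open import Data.Sign as Sign using (Sign)
open import Data.Bool using (Bool; true; false; if_then_else_; _∨_; T)
import Data.Bool.Properties as BoolP
open import Data.Fin as Fin using (Fin)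
import Data.Fin.Properties as FinP
open import Data.List using (List; []; _∷_; length; lookup)
open import Data.List.Relation.Unary.All as All using (All; []; _∷_)
open import Data.List.Relation.Unary.AllPairs using (AllPairs; []; _∷_)
open import Data.Product using (∃; ∃₂; _×_; _,_; proj₁; proj₂)
open import Data.Sum using (_⊎_; inj₁; inj₂)
open import Data.Empty using (⊥-elim)
open import Data.Maybe using (map)
open import Effect.Monad using (RawMonad)
open import Relation.Nullary using (¬_; yes; no)
open import Relation.Nullary.Decidable using (dec⇒maybe; ¬¬-excluded-middle; decidable-stable)
open import Relation.Nullary.Negation using (¬¬-Monad)
open import Relation.Binary.PropositionalEquality
open import Relation.Binary.Structures using (IsPreorder)
open import Algebra.Bundles using (CommutativeRing)
open import Algebra.Structures using (IsCommutativeRing)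
import Algebra.Solver.Ring.AlmostCommutativeRing as ACR
import Algebra.Solver.Ring

module RealFieldProperties (ℝ : RealField) where
  open RealField ℝ
  open ≡-Reasoning

  isCommutativeRing : IsCommutativeRing _≡_ _+_ _*_ -_ 0r 1r
  isCommutativeRing = record
    { isRing = record
      { +-isAbelianGroup = record
        { isGroup = record
          { isMonoid = record
            { isSemigroup = record
              { isMagma = record { isEquivalence = isEquivalence ; ∙-cong = cong₂ _+_ }
              ; assoc = +-assoc }
            ; identity = (λ x → trans (+-comm 0r x) (+-identity x)) , +-identity }
          ; inverse = (λ x → trans (+-comm (- x) x) (+-inverse x)) , +-inverse
          ; ⁻¹-cong = cong (λ x → - x) }
        ; comm = +-comm }
      ; *-cong = cong₂ _*_
      ; *-assoc = *-assoc
      ; *-identity = (λ x → trans (*-comm 1r x) (*-identity x)) , *-identity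
      ; distrib = distrib , λ x y z → trans (*-comm (y + z) x)
                    (trans (distrib x y z) (cong₂ _+_ (*-comm x y) (*-comm x z))) }
    ; *-comm = *-comm }

  commutativeRing : CommutativeRing _ _
  commutativeRing = record { isCommutativeRing = isCommutativeRing }

  open CommutativeRing commutativeRing public
    using (+-identityˡ; *-identityˡ; distribʳ; zeroˡ; zeroʳ)
  open import Algebra.Properties.Ring (CommutativeRing.ring commutativeRing) public
    using (-‿involutive; -0#≈0#; -1*x≈-x)
  open import Algebra.Properties.AbelianGroup (CommutativeRing.+-abelianGroup commutativeRing)
    using (⁻¹-∙-comm)

  -‿distrib-+ : ∀ x y → - (x + y) ≡ - x + - y
  -‿distrib-+ x y = sym (⁻¹-∙-comm x y)

  fromℤ : ℤ → R
  fromℤ (ℤ.+ n)  = fromℕ n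
  fromℤ -[1+ n ] = - fromℕ (suc n)

  fromℕ-+ : ∀ m n → fromℕ (m ℕ.+ n) ≡ fromℕ m + fromℕ n
  fromℕ-+ zero    n = sym (+-identityˡ _)
  fromℕ-+ (suc m) n = trans (cong (1r +_) (fromℕ-+ m n)) (sym (+-assoc _ _ _))

  fromℕ-* : ∀ m n → fromℕ (m ℕ.* n) ≡ fromℕ m * fromℕ n
  fromℕ-* zero    n = sym (zeroˡ _)
  fromℕ-* (suc m) n = begin
    fromℕ (n ℕ.+ m ℕ.* n)             ≡⟨ fromℕ-+ n (m ℕ.* n) ⟩
    fromℕ n + fromℕ (m ℕ.* n)         ≡⟨ cong₂ _+_ (sym (*-identityˡ _)) (fromℕ-* m n) ⟩
    1r * fromℕ n + fromℕ m * fromℕ n  ≡⟨ sym (distribʳ _ _ _) ⟩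
    (1r + fromℕ m) * fromℕ n          ∎

  fromℤ-⊖ : ∀ m n → fromℤ (m ⊖ n) ≡ fromℕ m - fromℕ n
  fromℤ-⊖ m       zero    = sym (trans (cong (fromℕ m +_) -0#≈0#) (+-identity _))
  fromℤ-⊖ zero    (suc n) = sym (+-identityˡ _)
  fromℤ-⊖ (suc m) (suc n) = begin
    fromℤ (suc m ⊖ suc n)                      ≡⟨ cong fromℤ (ℤP.[1+m]⊖[1+n]≡m⊖n m n) ⟩
    fromℤ (m ⊖ n)                              ≡⟨ fromℤ-⊖ m n ⟩
    fromℕ m - fromℕ n                          ≡⟨ cong (_- fromℕ n) (sym (+-identityˡ _)) ⟩
    (0r + fromℕ m) - fromℕ n                   ≡⟨ cong (λ u → (u + fromℕ m) - fromℕ n) (sym (+-inverse 1r)) ⟩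
    ((1r - 1r) + fromℕ m) - fromℕ n            ≡⟨ regroup 1r (- 1r) (fromℕ m) (- fromℕ n) ⟩
    (1r + fromℕ m) + (- 1r + - fromℕ n)        ≡⟨ cong ((1r + fromℕ m) +_) (sym (-‿distrib-+ 1r (fromℕ n))) ⟩
    (1r + fromℕ m) - (1r + fromℕ n)            ∎
    where
    regroup : ∀ a b c e → ((a + b) + c) + e ≡ (a + c) + (b + e)
    regroup a b c e = begin
      ((a + b) + c) + e  ≡⟨ cong (_+ e) (+-assoc a b c) ⟩
      (a + (b + c)) + e  ≡⟨ cong (λ u → (a + u) + e) (+-comm b c) ⟩
      (a + (c + b)) + e  ≡⟨ cong (_+ e) (sym (+-assoc a c b)) ⟩
      ((a + c) + b) + e  ≡⟨ +-assoc (a + c) b e ⟩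
      (a + c) + (b + e)  ∎

  fromℤ-neg : ∀ i → fromℤ (ℤ.- i) ≡ - fromℤ i
  fromℤ-neg +0       = sym -0#≈0#
  fromℤ-neg +[1+ n ] = refl
  fromℤ-neg -[1+ n ] = sym (-‿involutive _)

  fromℤ-+ : ∀ i j → fromℤ (i ℤ.+ j) ≡ fromℤ i + fromℤ j
  fromℤ-+ -[1+ m ] -[1+ n ] = begin
    - fromℕ (suc (suc (m ℕ.+ n)))     ≡⟨ cong (λ u → - fromℕ (suc u)) (sym (ℕP.+-suc m n)) ⟩
    - fromℕ (suc m ℕ.+ suc n)         ≡⟨ cong -_ (fromℕ-+ (suc m) (suc n)) ⟩
    - (fromℕ (suc m) + fromℕ (suc n)) ≡⟨ -‿distrib-+ _ _ ⟩
    - fromℕ (suc m) + - fromℕ (suc n) ∎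
  fromℤ-+ -[1+ m ] (ℤ.+ n)  = trans (fromℤ-⊖ n (suc m)) (+-comm _ _)
  fromℤ-+ (ℤ.+ m)  -[1+ n ] = fromℤ-⊖ m (suc n)
  fromℤ-+ (ℤ.+ m)  (ℤ.+ n)  = fromℕ-+ m n

  fromSign : Sign → R
  fromSign Sign.+ = 1r
  fromSign Sign.- = - 1r

  fromSign-* : ∀ s t → fromSign (s Sign.* t) ≡ fromSign s * fromSign t
  fromSign-* Sign.+ Sign.+ = sym (*-identity _)
  fromSign-* Sign.+ Sign.- = sym (*-identityˡ _)
  fromSign-* Sign.- Sign.+ = sym (*-identity _)
  fromSign-* Sign.- Sign.- = sym (trans (-1*x≈-x (- 1r)) (-‿involutive 1r))

  fromℤ-◃ : ∀ s n → fromℤ (s ◃ n) ≡ fromSign s * fromℕ n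
  fromℤ-◃ s      zero    = sym (zeroʳ _)
  fromℤ-◃ Sign.+ (suc n) = sym (*-identityˡ _)
  fromℤ-◃ Sign.- (suc n) = sym (-1*x≈-x _)

  fromℤ-signAbs : ∀ i → fromℤ i ≡ fromSign (sign i) * fromℕ ∣ i ∣
  fromℤ-signAbs i = trans (cong fromℤ (sym (ℤP.◃-inverse i))) (fromℤ-◃ (sign i) ∣ i ∣)

  *-interchange : ∀ a b c e → (a * b) * (c * e) ≡ (a * c) * (b * e)
  *-interchange a b c e = begin
    (a * b) * (c * e) ≡⟨ *-assoc a b (c * e) ⟩
    a * (b * (c * e)) ≡⟨ cong (a *_) (sym (*-assoc b c e)) ⟩
    a * ((b * c) * e) ≡⟨ cong (λ u → a * (u * e)) (*-comm b c) ⟩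
    a * ((c * b) * e) ≡⟨ cong (a *_) (*-assoc c b e) ⟩
    a * (c * (b * e)) ≡⟨ sym (*-assoc a c (b * e)) ⟩
    (a * c) * (b * e) ∎

  fromℤ-* : ∀ i j → fromℤ (i ℤ.* j) ≡ fromℤ i * fromℤ j
  fromℤ-* i j = begin
    fromℤ (i ℤ.* j)
      ≡⟨ fromℤ-◃ (sign i Sign.* sign j) (∣ i ∣ ℕ.* ∣ j ∣) ⟩
    fromSign (sign i Sign.* sign j) * fromℕ (∣ i ∣ ℕ.* ∣ j ∣)
      ≡⟨ cong₂ _*_ (fromSign-* (sign i) (sign j)) (fromℕ-* ∣ i ∣ ∣ j ∣) ⟩
    (fromSign (sign i) * fromSign (sign j)) * (fromℕ ∣ i ∣ * fromℕ ∣ j ∣)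
      ≡⟨ *-interchange _ _ _ _ ⟩
    (fromSign (sign i) * fromℕ ∣ i ∣) * (fromSign (sign j) * fromℕ ∣ j ∣)
      ≡⟨ sym (cong₂ _*_ (fromℤ-signAbs i) (fromℤ-signAbs j)) ⟩
    fromℤ i * fromℤ j ∎

  fromℤ-suc : ∀ k → fromℤ (ℤ.suc k) ≡ fromℤ k + 1r
  fromℤ-suc k = trans (fromℤ-+ ℤ.1ℤ k) (trans (+-comm _ _) (cong (fromℤ k +_) (+-identity 1r)))

  fromℤ-pred : ∀ k → fromℤ (ℤ.pred k) ≡ fromℤ k - 1r
  fromℤ-pred k = trans (fromℤ-+ ℤ.-1ℤ k) (trans (+-comm _ _) (cong (λ u → fromℤ k + - u) (+-identity 1r)))

  -- fromℕ 1 is 1r + 0r; the solver reads its constants through literal, which sends 1 to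
  -- 1r itself, so that normal forms of goals mentioning 1r agree by refl.
  literalℕ : ℕ → R
  literalℕ zero          = 0r
  literalℕ (suc zero)    = 1r
  literalℕ (suc (suc n)) = 1r + literalℕ (suc n)

  literalℕ≡fromℕ : ∀ n → literalℕ n ≡ fromℕ n
  literalℕ≡fromℕ zero          = refl
  literalℕ≡fromℕ (suc zero)    = sym (+-identity 1r)
  literalℕ≡fromℕ (suc (suc n)) = cong (1r +_) (literalℕ≡fromℕ (suc n))

  literal : ℤ → R
  literal (ℤ.+ n)  = literalℕ n
  literal -[1+ n ] = - literalℕ (suc n)

  literal≡fromℤ : ∀ i → literal i ≡ fromℤ i
  literal≡fromℤ (ℤ.+ n)  = literalℕ≡fromℕ n
  literal≡fromℤ -[1+ n ] = cong -_ (literalℕ≡fromℕ (suc n))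

  literal-homomorphism : ACR._-Raw-AlmostCommutative⟶_ ℤ.+-*-rawRing
                           (ACR.fromCommutativeRing commutativeRing)
  literal-homomorphism = record
    { ⟦_⟧    = literal
    ; +-homo = λ i j → via (i ℤ.+ j) (fromℤ-+ i j) (cong₂ _+_ (literal≡fromℤ i) (literal≡fromℤ j))
    ; *-homo = λ i j → via (i ℤ.* j) (fromℤ-* i j) (cong₂ _*_ (literal≡fromℤ i) (literal≡fromℤ j))
    ; -‿homo = λ i → via (ℤ.- i) (fromℤ-neg i) (cong -_ (literal≡fromℤ i))
    ; 0-homo = refl
    ; 1-homo = refl }
    where
    via : ∀ i {x y} → fromℤ i ≡ y → x ≡ y → literal i ≡ x
    via i fromℤ-i≡y x≡y = trans (literal≡fromℤ i) (trans fromℤ-i≡y (sym x≡y))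

  module Solver = Algebra.Solver.Ring ℤ.+-*-rawRing (ACR.fromCommutativeRing commutativeRing)
    literal-homomorphism (λ i j → map (cong literal) (dec⇒maybe (i ℤ.≟ j)))

  ≤-reflexive : ∀ {x y} → x ≡ y → x ≤ y
  ≤-reflexive {x} refl = ≤-refl x

  +-monoʳ-≤ : ∀ {x y} z → x ≤ y → z + x ≤ z + y
  +-monoʳ-≤ {x} {y} z x≤y = subst₂ _≤_ (+-comm x z) (+-comm y z) (+-mono-≤ z x≤y)

  x+y-y≡x : ∀ x y → (x + y) - y ≡ x
  x+y-y≡x = Solver.solve 2 (λ x y → (x :+ y) :- y := x) refl
    where open Solver

  x-y+y≡x : ∀ x y → (x - y) + y ≡ x
  x-y+y≡x = Solver.solve 2 (λ x y → (x :- y) :+ y := x) refl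
    where open Solver

  +-cancelʳ-≤ : ∀ {x y} z → x + z ≤ y + z → x ≤ y
  +-cancelʳ-≤ {x} {y} z p = subst₂ _≤_ (x+y-y≡x x z) (x+y-y≡x y z) (+-mono-≤ (- z) p)

  x≤y⇒0≤y-x : ∀ {x y} → x ≤ y → 0r ≤ y - x
  x≤y⇒0≤y-x {x} p = subst₂ _≤_ (+-inverse x) refl (+-mono-≤ (- x) p)

  0≤y-x⇒x≤y : ∀ {x y} → 0r ≤ y - x → x ≤ y
  0≤y-x⇒x≤y {x} {y} p = subst₂ _≤_ (+-identityˡ x) (x-y+y≡x y x) (+-mono-≤ x p)

  neg-antimono-≤ : ∀ {x y} → x ≤ y → - y ≤ - x
  neg-antimono-≤ {x} {y} p = 0≤y-x⇒x≤y (subst (0r ≤_) (ring x y) (x≤y⇒0≤y-x p))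
    where
    ring : ∀ x y → y - x ≡ - x - - y
    ring = Solver.solve 2 (λ x y → y :- x := :- x :- :- y) refl
      where open Solver

  *-monoˡ-≤-nonNeg : ∀ {x y} c → 0r ≤ c → x ≤ y → c * x ≤ c * y
  *-monoˡ-≤-nonNeg {x} {y} c 0≤c p = 0≤y-x⇒x≤y (subst (0r ≤_) (ring c x y) (*-nonneg 0≤c (x≤y⇒0≤y-x p)))
    where
    ring : ∀ c x y → c * (y - x) ≡ c * y - c * x
    ring = Solver.solve 3 (λ c x y → c :* (y :- x) := c :* y :- c :* x) refl
      where open Solver

  0≤1 : 0r ≤ 1r
  0≤1 with ≤-total 0r 1r
  ... | inj₁ 0≤1 = 0≤1
  ... | inj₂ 1≤0 = subst (0r ≤_) -1*-1≡1 (*-nonneg 0≤-1 0≤-1)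
    where
    0≤-1 : 0r ≤ - 1r
    0≤-1 = subst₂ _≤_ -0#≈0# refl (neg-antimono-≤ 1≤0)
    -1*-1≡1 : - 1r * - 1r ≡ 1r
    -1*-1≡1 = Solver.solve 0 (:- con ℤ.1ℤ :* :- con ℤ.1ℤ := con ℤ.1ℤ) refl
      where open Solver

  <-irrefl : ∀ {x} → ¬ (x < x)
  <-irrefl (_ , x≢x) = x≢x refl

  <-≤-trans : ∀ {x y z} → x < y → y ≤ z → x < z
  <-≤-trans (x≤y , x≢y) y≤z = ≤-trans x≤y y≤z , λ { refl → x≢y (≤-antisym x≤y y≤z) }

  ≤-<-trans : ∀ {x y z} → x ≤ y → y < z → x < z
  ≤-<-trans x≤y (y≤z , y≢z) = ≤-trans x≤y y≤z , λ { refl → y≢z (≤-antisym y≤z x≤y) }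

  <⇒≱ : ∀ {x y} → x < y → ¬ (y ≤ x)
  <⇒≱ (x≤y , x≢y) y≤x = x≢y (≤-antisym x≤y y≤x)

  ≰⇒> : ∀ {x y} → ¬ (x ≤ y) → y < x
  ≰⇒> {x} {y} x≰y with ≤-total x y
  ... | inj₁ x≤y = ⊥-elim (x≰y x≤y)
  ... | inj₂ y≤x = y≤x , λ { refl → x≰y (≤-refl y) }

  0<1 : 0r < 1r
  0<1 = 0≤1 , 0≢1

  +-monoˡ-< : ∀ {x y} z → x < y → x + z < y + z
  +-monoˡ-< z (x≤y , x≢y) =
    +-mono-≤ z x≤y , λ e → x≢y (≤-antisym x≤y (+-cancelʳ-≤ z (≤-reflexive (sym e))))

  +-monoʳ-< : ∀ {x y} z → x < y → z + x < z + y
  +-monoʳ-< {x} {y} z p = subst₂ _<_ (+-comm x z) (+-comm y z) (+-monoˡ-< z p)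

  InUnitInterval : R → R → Set
  InUnitInterval a x = a ≤ x × x < a + 1r

  InUnitInterval-+ : ∀ {a x} t → InUnitInterval a x → InUnitInterval (a + t) (x + t)
  InUnitInterval-+ {a} {x} t (a≤x , x<a+1) = +-mono-≤ t a≤x , subst (x + t <_) (ring a t) (+-monoˡ-< t x<a+1)
    where
    ring : ∀ a t → (a + 1r) + t ≡ (a + t) + 1r
    ring = Solver.solve 2 (λ a t → (a :+ con ℤ.1ℤ) :+ t := (a :+ t) :+ con ℤ.1ℤ) refl
      where open Solver

  x<x+1 : ∀ x → x < x + 1r
  x<x+1 x = subst₂ _<_ (+-identity x) refl (+-monoʳ-< x 0<1)

  ≤+1⇒-1≤ : ∀ {x y} → x ≤ y + 1r → x - 1r ≤ y
  ≤+1⇒-1≤ {y = y} p = subst₂ _≤_ refl (x+y-y≡x y 1r) (+-mono-≤ (- 1r) p)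

  <+1⇒-1< : ∀ {x y} → x < y + 1r → x - 1r < y
  <+1⇒-1< {y = y} p = subst₂ _<_ refl (x+y-y≡x y 1r) (+-monoˡ-< (- 1r) p)

  x<y⇒0<y-x : ∀ {x y} → x < y → 0r < y - x
  x<y⇒0<y-x {x} {y} (x≤y , x≢y) = x≤y⇒0≤y-x x≤y , λ 0≡y-x →
    x≢y (trans (sym (+-identityˡ x)) (trans (cong (_+ x) 0≡y-x) (x-y+y≡x y x)))

  *-cancelˡ-≡ : ∀ {x y} c → c ≢ 0r → c * x ≡ c * y → x ≡ y
  *-cancelˡ-≡ {x} {y} c c≢0 e with *-inverse c c≢0
  ... | (c⁻¹ , cc⁻¹≡1) = begin
    x                ≡⟨ sym (*-identityˡ x) ⟩
    1r * x           ≡⟨ cong (_* x) (trans (sym cc⁻¹≡1) (*-comm c c⁻¹)) ⟩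
    (c⁻¹ * c) * x    ≡⟨ *-assoc c⁻¹ c x ⟩
    c⁻¹ * (c * x)    ≡⟨ cong (c⁻¹ *_) e ⟩
    c⁻¹ * (c * y)    ≡⟨ sym (*-assoc c⁻¹ c y) ⟩
    (c⁻¹ * c) * y    ≡⟨ cong (_* y) (trans (*-comm c⁻¹ c) cc⁻¹≡1) ⟩
    1r * y           ≡⟨ *-identityˡ y ⟩
    y                ∎

  *-pos : ∀ {x y} → 0r < x → 0r < y → 0r < x * y
  *-pos {x} {y} (0≤x , 0≢x) (0≤y , 0≢y) = *-nonneg 0≤x 0≤y , λ 0≡xy →
    0≢y (sym (*-cancelˡ-≡ x (λ x≡0 → 0≢x (sym x≡0)) (trans (sym 0≡xy) (sym (zeroʳ x)))))

  *-monoˡ-<-pos : ∀ {x y} c → 0r < c → x < y → c * x < c * y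
  *-monoˡ-<-pos c (0≤c , 0≢c) (x≤y , x≢y) =
    *-monoˡ-≤-nonNeg c 0≤c x≤y , λ e → x≢y (*-cancelˡ-≡ c (λ c≡0 → 0≢c (sym c≡0)) e)

  ≤-isPreorder : IsPreorder _≡_ _≤_
  ≤-isPreorder = record { isEquivalence = isEquivalence ; reflexive = ≤-reflexive ; trans = ≤-trans }

  module ≤-Reasoning where
    open import Relation.Binary.Reasoning.Base.Triple
      ≤-isPreorder
      (λ x<y y<x → <⇒≱ x<y (proj₁ y<x))
      (λ x<y y<z → <-≤-trans x<y (proj₁ y<z))
      (resp₂ _<_)
      proj₁
      <-≤-trans
      ≤-<-trans
      public
      hiding (step-≈; step-≈˘; step-≈-⟩; step-≈-⟨)

  0≤fromℕ : ∀ n → 0r ≤ fromℕ n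
  0≤fromℕ zero    = ≤-refl 0r
  0≤fromℕ (suc n) = ≤-trans (subst₂ _≤_ (+-identity 0r) refl (+-mono-≤ 0r 0≤1)) (+-monoʳ-≤ 1r (0≤fromℕ n))

  fromℤ-mono-≤ : ∀ {i j} → i ℤ.≤ j → fromℤ i ≤ fromℤ j
  fromℤ-mono-≤ {i} {j} i≤j = 0≤y-x⇒x≤y (subst₂ _≤_ refl (begin
    fromℕ ∣ j ℤ.- i ∣        ≡⟨ cong fromℤ (ℤP.0≤i⇒+∣i∣≡i (ℤP.i≤j⇒0≤j-i i≤j)) ⟩
    fromℤ (j ℤ.- i)         ≡⟨ fromℤ-+ j (ℤ.- i) ⟩
    fromℤ j + fromℤ (ℤ.- i) ≡⟨ cong (fromℤ j +_) (fromℤ-neg i) ⟩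
    fromℤ j - fromℤ i       ∎) (0≤fromℕ ∣ j ℤ.- i ∣))

  fromℤ-cancel-< : ∀ {i j} → fromℤ i < fromℤ j → i ℤ.< j
  fromℤ-cancel-< {i} {j} p with i ℤ.<? j
  ... | yes i<j = i<j
  ... | no  i≮j = ⊥-elim (<⇒≱ p (fromℤ-mono-≤ (ℤP.≮⇒≥ i≮j)))

  private
    1+1≢0 : 1r + 1r ≢ 0r
    1+1≢0 2≡0 =
      <⇒≱ (<-≤-trans 0<1 (subst₂ _≤_ (+-identity 1r) refl (+-monoʳ-≤ 1r 0≤1))) (≤-reflexive 2≡0)

  half : R
  half = proj₁ (*-inverse (1r + 1r) 1+1≢0)

  half+half≡1 : half + half ≡ 1r
  half+half≡1 = begin
    half + half              ≡⟨ sym (cong₂ _+_ (*-identityˡ half) (*-identityˡ half)) ⟩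
    1r * half + 1r * half    ≡⟨ sym (distribʳ half 1r 1r) ⟩
    (1r + 1r) * half         ≡⟨ proj₂ (*-inverse (1r + 1r) 1+1≢0) ⟩
    1r                       ∎

  0<half : 0r < half
  0<half with ≤-total 0r half
  ... | inj₁ 0≤h = 0≤h , λ 0≡h → 0≢1 (trans (sym (+-identity 0r)) (trans (cong₂ _+_ 0≡h 0≡h) half+half≡1))
  ... | inj₂ h≤0 = ⊥-elim (<⇒≱ 0<1 (subst₂ _≤_ half+half≡1 (+-identity 0r)
                     (≤-trans (+-mono-≤ half h≤0) (+-monoʳ-≤ 0r h≤0))))

module Floor (ℝ : RealField) where
  open RealField ℝ
  open RealFieldProperties ℝ
  open RawMonad (¬¬-Monad {a = 0ℓ})

  IsIntegerFloor : R → ℤ → Set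
  IsIntegerFloor z k = InUnitInterval (fromℤ k) z

  ¬¬≤⇒≤+pos : ∀ {x y δ} → ¬ ¬ (x ≤ y) → 0r < δ → x ≤ y + δ
  ¬¬≤⇒≤+pos {x} {y} {δ} ¬¬x≤y (0≤δ , 0≢δ) with ≤-total x (y + δ)
  ... | inj₁ x≤y+δ = x≤y+δ
  ... | inj₂ y+δ≤x = ⊥-elim (¬¬x≤y λ x≤y → 0≢δ (≤-antisym 0≤δ
          (+-cancelʳ-≤ y (subst₂ _≤_ (+-comm y δ) (sym (+-identityˡ y)) (≤-trans y+δ≤x x≤y)))))

  ≤+pos⇒≯ : ∀ {x y} → (∀ δ → 0r < δ → x ≤ y + δ) → ¬ (y < x)
  ≤+pos⇒≯ {x} {y} x≤y+ y<x = <⇒≱ 0<δ (begin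
    δ                    ≡⟨ δ≡x-y-δ ⟩
    x + (- y - δ)        ≤⟨ +-mono-≤ (- y - δ) (x≤y+ δ 0<δ) ⟩
    (y + δ) + (- y - δ)  ≡⟨ Solver.solve 2 (λ y δ → (y :+ δ) :+ (:- y :- δ) := con ℤ.0ℤ) refl y δ ⟩
    0r                   ∎)
    where
    open ≤-Reasoning
    open Solver using (_:+_; _:-_; :-_; _:*_; _:=_; con)
    δ : R
    δ = (x - y) * half
    0<δ : 0r < δ
    0<δ = *-pos (x<y⇒0<y-x y<x) 0<half
    δ≡x-y-δ : δ ≡ x + (- y - δ)
    δ≡x-y-δ = begin-equality
      (x - y) * half                            ≡⟨ ring₁ x y half ⟩
      (x - y) * (half + half) - (x - y) * half  ≡⟨ cong (λ u → (x - y) * u - (x - y) * half) half+half≡1 ⟩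
      (x - y) * 1r - (x - y) * half             ≡⟨ ring₂ x y half ⟩
      x + (- y - (x - y) * half)                ∎
      where
      ring₁ : ∀ x y h → (x - y) * h ≡ (x - y) * (h + h) - (x - y) * h
      ring₁ = Solver.solve 3 (λ x y h → (x :- y) :* h := (x :- y) :* (h :+ h) :- (x :- y) :* h) refl
      ring₂ : ∀ x y h → (x - y) * 1r - (x - y) * h ≡ x + (- y - (x - y) * h)
      ring₂ = Solver.solve 3 (λ x y h → (x :- y) :* con ℤ.1ℤ :- (x :- y) :* h
                                       := x :+ (:- y :- (x :- y) :* h)) refl

  archimedean : ∀ z → ¬ ¬ (∃ λ N → z ≤ fromℕ N)
  archimedean z unbounded = <⇒≱ 0<1 1≤0
    where
    open ≤-Reasoning
    open Solver using (_:+_; _:-_; _:=_; con)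
    fromℕ≤z : ∀ N → fromℕ N ≤ z
    fromℕ≤z N with ≤-total z (fromℕ N)
    ... | inj₁ z≤N = ⊥-elim (unbounded (N , z≤N))
    ... | inj₂ N≤z = N≤z
    BelowSomeℕ : R → Set
    BelowSomeℕ u = ∃ λ N → u ≤ fromℕ N
    supremum = sup BelowSomeℕ (0r , 0 , ≤-refl 0r) (z , λ u (N , u≤N) → ≤-trans u≤N (fromℕ≤z N))
    s = proj₁ supremum
    s≤s-1 : s ≤ s - 1r
    s≤s-1 = proj₂ (proj₂ supremum) (s - 1r) λ u (N , u≤N) → begin
      u                   ≤⟨ u≤N ⟩
      fromℕ N             ≡⟨ Solver.solve 1 (λ n → n := (con ℤ.1ℤ :+ n) :- con ℤ.1ℤ) refl (fromℕ N) ⟩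
      fromℕ (suc N) - 1r  ≤⟨ +-mono-≤ (- 1r) (proj₁ (proj₂ supremum) _ (suc N , ≤-refl _)) ⟩
      s - 1r              ∎
    1≤0 : 1r ≤ 0r
    1≤0 = begin
      1r                   ≡⟨ Solver.solve 1 (λ s → con ℤ.1ℤ := s :+ (con ℤ.1ℤ :- s)) refl s ⟩
      s + (1r - s)         ≤⟨ +-mono-≤ (1r - s) s≤s-1 ⟩
      (s - 1r) + (1r - s)  ≡⟨ Solver.solve 1 (λ s → (s :- con ℤ.1ℤ) :+ (con ℤ.1ℤ :- s) := con ℤ.0ℤ) refl s ⟩
      0r                   ∎

  integerFloor-search : ∀ n k z → fromℤ k ≤ z → z ≤ fromℤ k + fromℕ n → ¬ ¬ (∃ (IsIntegerFloor z))
  integerFloor-search zero    k z k≤z z≤k+0 =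
    pure (k , k≤z , ≤-<-trans (subst (z ≤_) (+-identity _) z≤k+0) (x<x+1 _))
  integerFloor-search (suc n) k z k≤z z≤k+1+n = do
    k+1≤z? ← ¬¬-excluded-middle
    case k+1≤z? of λ where
      (yes k+1≤z) → integerFloor-search n (ℤ.suc k) z (subst (_≤ z) (sym (fromℤ-suc k)) k+1≤z)
                      (subst (z ≤_) (trans (sym (+-assoc _ _ _)) (cong (_+ fromℕ n) (sym (fromℤ-suc k)))) z≤k+1+n)
      (no  k+1≰z) → pure (k , k≤z , ≰⇒> k+1≰z)

  integerFloor : ∀ z → ¬ ¬ (∃ (IsIntegerFloor z))
  integerFloor z = do
    (M , -z≤M) ← archimedean (- z)
    (N , z≤N) ← archimedean z
    integerFloor-search (M ℕ.+ N) (ℤ.- ℤ.+ M) z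
      (subst₂ _≤_ (sym (fromℤ-neg (ℤ.+ M))) (-‿involutive z) (neg-antimono-≤ -z≤M))
      (subst (z ≤_) (sym (-M+[M+N]≡N M N)) z≤N)
    where
    -M+[M+N]≡N : ∀ M N → fromℤ (ℤ.- ℤ.+ M) + fromℕ (M ℕ.+ N) ≡ fromℕ N
    -M+[M+N]≡N M N = trans (cong₂ _+_ (fromℤ-neg (ℤ.+ M)) (fromℕ-+ M N))
      (Solver.solve 2 (λ m n → :- m :+ (m :+ n) := n) refl (fromℕ M) (fromℕ N))
      where open Solver

  -- The first disjunct makes the set inhabited;
  -- integers below z are only known up to double negation, and the slack δ still keeps z an
  -- upper bound (¬¬≤⇒≤+pos).
  FloorCandidate : R → R → Set
  FloorCandidate z u = u ≤ z - 1r ⊎ ∃₂ λ k δ → 0r < δ × u + δ ≤ fromℤ k × ¬ ¬ (fromℤ k ≤ z)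

  x-1≤x : ∀ x → x - 1r ≤ x
  x-1≤x x = subst₂ _≤_ refl (+-identity x) (+-monoʳ-≤ x (subst₂ _≤_ refl -0#≈0# (neg-antimono-≤ 0≤1)))

  x≤x+pos : ∀ x {δ} → 0r < δ → x ≤ x + δ
  x≤x+pos x (0≤δ , _) = subst₂ _≤_ (+-identity x) refl (+-monoʳ-≤ x 0≤δ)

  candidate≤ : ∀ {z u} → FloorCandidate z u → u ≤ z
  candidate≤ {z} (inj₁ u≤z-1) = ≤-trans u≤z-1 (x-1≤x z)
  candidate≤ (inj₂ (k , δ , 0<δ , u+δ≤k , ¬¬k≤z)) =
    +-cancelʳ-≤ δ (≤-trans u+δ≤k (¬¬≤⇒≤+pos ¬¬k≤z 0<δ))

  private
    floorSup : ∀ z → _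
    floorSup z = sup (FloorCandidate z) (z - 1r , inj₁ (≤-refl _)) (z , λ _ → candidate≤)

  floor : R → R
  floor z = proj₁ (floorSup z)

  candidate≤floor : ∀ {z u} → FloorCandidate z u → u ≤ floor z
  candidate≤floor {z} = proj₁ (proj₂ (floorSup z)) _

  floor≤bound : ∀ {z b} → (∀ u → FloorCandidate z u → u ≤ b) → floor z ≤ b
  floor≤bound {z} = proj₂ (proj₂ (floorSup z)) _

  floor-≤ : ∀ z → floor z ≤ z
  floor-≤ z = floor≤bound (λ _ → candidate≤)

  z-1≤floor : ∀ z → z - 1r ≤ floor z
  z-1≤floor z = candidate≤floor (inj₁ (≤-refl _))

  ¬¬≤⇒≤floor+pos : ∀ {z δ} k → ¬ ¬ (fromℤ k ≤ z) → 0r < δ → fromℤ k ≤ floor z + δ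
  ¬¬≤⇒≤floor+pos {z} {δ} k ¬¬k≤z 0<δ = subst₂ _≤_ (x-y+y≡x (fromℤ k) δ) refl (+-mono-≤ δ
    (candidate≤floor (inj₂ (k , δ , 0<δ , ≤-reflexive (x-y+y≡x (fromℤ k) δ) , ¬¬k≤z))))

  <⇒floor+1≤ : ∀ {z} n → z < fromℤ n → floor z + 1r ≤ fromℤ n
  <⇒floor+1≤ {z} n z<n = subst₂ _≤_ refl (x-y+y≡x (fromℤ n) 1r)
    (+-mono-≤ 1r (floor≤bound λ where
      u (inj₁ u≤z-1) → ≤-trans u≤z-1 (+-mono-≤ (- 1r) (proj₁ z<n))
      u (inj₂ (k , δ , 0<δ , u+δ≤k , ¬¬k≤z)) →
        ≤-trans (x≤x+pos u 0<δ) (≤-trans u+δ≤k (k≤n-1 {k} ¬¬k≤z))))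
    where
    open Solver
    k≤n-1 : ∀ {k} → ¬ ¬ (fromℤ k ≤ z) → fromℤ k ≤ fromℤ n - 1r
    k≤n-1 {k} ¬¬k≤z with k ℤ.<? n
    ... | yes k<n = subst₂ _≤_ refl (fromℤ-pred n) (fromℤ-mono-≤ (ℤP.i<j⇒i≤pred[j] k<n))
    ... | no  k≮n = ⊥-elim (¬¬k≤z (<⇒≱ (<-≤-trans z<n (fromℤ-mono-≤ (ℤP.≮⇒≥ k≮n)))))

  floor≡integerFloor : ∀ {z} k → IsIntegerFloor z k → ¬ ¬ (floor z ≡ fromℤ k)
  floor≡integerFloor {z} k (k≤z , z<k+1) floor≢k =
    ≤+pos⇒≯ (λ δ 0<δ → ¬¬≤⇒≤floor+pos k (λ k≰z → k≰z k≤z) 0<δ) (floor≤k , floor≢k)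
    where
    floor≤k : floor z ≤ fromℤ k
    floor≤k = +-cancelʳ-≤ 1r (subst₂ _≤_ refl (fromℤ-suc k)
                (<⇒floor+1≤ (ℤ.suc k) (subst₂ _<_ refl (sym (fromℤ-suc k)) z<k+1)))

  floor-integral : ∀ z → ¬ ¬ (∃ λ k → floor z ≡ fromℤ k)
  floor-integral z = do
    (k , isFloor) ← integerFloor z
    floor≡k ← floor≡integerFloor k isFloor
    pure (k , floor≡k)

  <-floor+1 : ∀ z → z < floor z + 1r
  <-floor+1 z = z≤floor+1 , λ z≡floor+1 → integerFloor z λ (k , isFloor) →
    floor≡integerFloor k isFloor λ floor≡k →
      <-irrefl (subst (_< fromℤ k + 1r) (trans z≡floor+1 (cong (_+ 1r) floor≡k)) (proj₂ isFloor))
    where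
    z≤floor+1 : z ≤ floor z + 1r
    z≤floor+1 = subst₂ _≤_ (x-y+y≡x z 1r) refl (+-mono-≤ 1r (z-1≤floor z))

  ¬¬≤-transfer : ∀ {x y} k → ¬ ¬ (fromℤ k ≤ y) → floor y ≤ x → ¬ ¬ (fromℤ k ≤ x)
  ¬¬≤-transfer k ¬¬k≤y floor-y≤x k≰x = ≤+pos⇒≯
    (λ δ 0<δ → ≤-trans (¬¬≤⇒≤floor+pos k ¬¬k≤y 0<δ) (+-mono-≤ δ floor-y≤x)) (≰⇒> k≰x)

  floor-cell : ∀ {x y} → InUnitInterval (floor y) x → floor x ≡ floor y
  floor-cell {x} {y} (floor-y≤x , x<floor-y+1) = ≤-antisym floor-x≤floor-y floor-y≤floor-x
    where
    floor-x≤floor-y : floor x ≤ floor y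
    floor-x≤floor-y = floor≤bound λ where
      u (inj₁ u≤x-1) → ≤-trans u≤x-1 (≤+1⇒-1≤ (proj₁ x<floor-y+1))
      u (inj₂ (k , δ , 0<δ , u+δ≤k , ¬¬k≤x)) → candidate≤floor (inj₂ (k , δ , 0<δ , u+δ≤k ,
        λ k≰y → ¬¬k≤x (<⇒≱ (<-≤-trans x<floor-y+1 (<⇒floor+1≤ k (≰⇒> k≰y))))))
    y-1≤floor-x : y - 1r ≤ floor x
    y-1≤floor-x with ≤-total (y - 1r) (floor x)
    ... | inj₁ y-1≤floor-x = y-1≤floor-x
    ... | inj₂ floor-x≤y-1 = ⊥-elim (integerFloor y λ (k , k≤y , y<k+1) →
          let ¬¬k≤x = ¬¬≤-transfer k (λ k≰y → k≰y k≤y) floor-y≤x in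
          ≤+pos⇒≯ (λ δ 0<δ → ≤-trans (¬¬≤⇒≤floor+pos k ¬¬k≤x 0<δ) (+-mono-≤ δ floor-x≤y-1))
                  (<+1⇒-1< y<k+1))
    floor-y≤floor-x : floor y ≤ floor x
    floor-y≤floor-x = floor≤bound λ where
      u (inj₁ u≤y-1) → ≤-trans u≤y-1 y-1≤floor-x
      u (inj₂ (k , δ , 0<δ , u+δ≤k , ¬¬k≤y)) →
        candidate≤floor (inj₂ (k , δ , 0<δ , u+δ≤k , ¬¬≤-transfer k ¬¬k≤y floor-y≤x))

digits-unique : ∀ n .{{_ : ℕ.NonZero n}} {a a′ b b′} → a ℕ.< n → a′ ℕ.< n →
                a ℕ.+ b ℕ.* n ≡ a′ ℕ.+ b′ ℕ.* n → a ≡ a′ × b ≡ b′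
digits-unique n {a} {a′} {b} {b′} a<n a′<n e = a≡a′ , b≡b′
  where
  a≡a′ : a ≡ a′
  a≡a′ = begin
    a                     ≡⟨ sym (m<n⇒m%n≡m a<n) ⟩
    a % n                 ≡⟨ sym ([m+kn]%n≡m%n a b n) ⟩
    (a ℕ.+ b ℕ.* n) % n   ≡⟨ cong (_% n) e ⟩
    (a′ ℕ.+ b′ ℕ.* n) % n ≡⟨ [m+kn]%n≡m%n a′ b′ n ⟩
    a′ % n                ≡⟨ m<n⇒m%n≡m a′<n ⟩
    a′                    ∎
    where open ≡-Reasoning
  b≡b′ : b ≡ b′
  b≡b′ = ℕP.*-cancelʳ-≡ b b′ n (ℕP.+-cancelˡ-≡ a _ _ (trans e (cong (ℕ._+ b′ ℕ.* n) (sym a≡a′))))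

∣n*i∣<n*k⇒∣i∣<k : ∀ n i k → ∣ ℤ.+ n ℤ.* i ∣ ℕ.< n ℕ.* k → ∣ i ∣ ℕ.< k
∣n*i∣<n*k⇒∣i∣<k n i k p =
  ℕP.*-cancelˡ-< n _ _ (subst (ℕ._< n ℕ.* k) (ℤP.∣i*j∣≡∣i∣*∣j∣ (ℤ.+ n) i) p)

∣n*i∣<n⇒i≡0 : ∀ n i → ∣ ℤ.+ n ℤ.* i ∣ ℕ.< n → i ≡ ℤ.0ℤ
∣n*i∣<n⇒i≡0 n i p = ℤP.∣i∣≡0⇒i≡0 (ℕP.n<1⇒n≡0
  (∣n*i∣<n*k⇒∣i∣<k n i 1 (subst (∣ ℤ.+ n ℤ.* i ∣ ℕ.<_) (sym (ℕP.*-identityʳ n)) p)))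

module Blocks (m : ℕ) where

  F : ℕ
  F = suc m

  isLast : ℕ → Bool
  rank : ℕ → ℕ
  isLast p = suc (rank p) ℕ.≡ᵇ F
  rank zero    = zero
  rank (suc p) = if isLast p then zero else suc (rank p)

  block : ℕ → ℕ
  block zero    = zero
  block (suc p) = if isLast p then suc (block p) else block p

  isLast⇒1+rank≡F : ∀ p → isLast p ≡ true → suc (rank p) ≡ F
  isLast⇒1+rank≡F p eq = ℕP.≡ᵇ⇒≡ (suc (rank p)) F (subst T (sym eq) _)

  rank<F : ∀ p → rank p ℕ.< F
  rank<F zero = s≤s z≤n
  rank<F (suc p) with isLast p in eq
  ... | true  = s≤s z≤n
  ... | false = ℕP.≤∧≢⇒< (rank<F p) (λ e → subst T eq (ℕP.≡⇒≡ᵇ _ _ e))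

  block*F+rank≡ : ∀ p → block p ℕ.* F ℕ.+ rank p ≡ p
  block*F+rank≡ zero = refl
  block*F+rank≡ (suc p) with isLast p in eq
  ... | false = trans (ℕP.+-suc _ (rank p)) (cong suc (block*F+rank≡ p))
  ... | true  = begin
    F ℕ.+ block p ℕ.* F ℕ.+ 0        ≡⟨ ℕP.+-identityʳ _ ⟩
    F ℕ.+ block p ℕ.* F              ≡⟨ cong (ℕ._+ block p ℕ.* F) (sym (isLast⇒1+rank≡F p eq)) ⟩
    suc (rank p) ℕ.+ block p ℕ.* F   ≡⟨ ℕP.+-comm (suc (rank p)) _ ⟩
    block p ℕ.* F ℕ.+ suc (rank p)   ≡⟨ ℕP.+-suc _ (rank p) ⟩
    suc (block p ℕ.* F ℕ.+ rank p)   ≡⟨ cong suc (block*F+rank≡ p) ⟩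
    suc p                            ∎
    where open ≡-Reasoning

  closing : ℕ → ℕ → Bool
  closing d q = isLast q ∨ (suc q ℕ.≡ᵇ d)

  closing-last : ∀ d → closing (suc d) d ≡ true
  closing-last d = trans (cong (isLast d ∨_) (≡ᵇ-refl d)) (BoolP.∨-zeroʳ (isLast d))
    where
    ≡ᵇ-refl : ∀ n → (suc n ℕ.≡ᵇ suc n) ≡ true
    ≡ᵇ-refl zero    = refl
    ≡ᵇ-refl (suc n) = ≡ᵇ-refl n

  #closing : ℕ → ℕ → ℕ
  #closing d zero    = zero
  #closing d (suc q) = if closing d q then suc (#closing d q) else #closing d q

  closing≡isLast : ∀ {d q} → suc q ℕ.< d → closing d q ≡ isLast q
  closing≡isLast {d} {q} sq<d with suc q ℕ.≡ᵇ d in eq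
  ... | false = BoolP.∨-identityʳ (isLast q)
  ... | true  = ⊥-elim (ℕP.<-irrefl (ℕP.≡ᵇ⇒≡ (suc q) d (subst T (sym eq) _)) sq<d)

  #closing≡block : ∀ {d q} → q ℕ.< d → #closing d q ≡ block q
  #closing≡block {q = zero}  _ = refl
  #closing≡block {d} {suc q} sq<d rewrite closing≡isLast sq<d =
    cong (λ n → if isLast q then suc n else n) (#closing≡block (ℕP.<⇒≤ sq<d))

  #closing≤ceilDiv : ∀ d → #closing d d ℕ.≤ ceilDiv d F
  #closing≤ceilDiv zero     = z≤n
  #closing≤ceilDiv (suc d) rewrite closing-last d = begin
    suc (#closing (suc d) d)    ≡⟨ cong suc (#closing≡block (ℕP.n<1+n d)) ⟩
    suc (block d)               ≡⟨ sym (m*n/n≡m (suc (block d)) F) ⟩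
    suc (block d) ℕ.* F / F     ≤⟨ /-monoˡ-≤ F blocks≤ ⟩
    (suc d ℕ.+ m) / F           ∎
    where
    open ℕP.≤-Reasoning
    blocks≤ : suc (block d) ℕ.* F ℕ.≤ suc d ℕ.+ m
    blocks≤ = begin
      F ℕ.+ block d ℕ.* F    ≤⟨ ℕP.+-monoʳ-≤ F (ℕP.m+n≤o⇒m≤o _ (ℕP.≤-reflexive (block*F+rank≡ d))) ⟩
      F ℕ.+ d                ≡⟨ cong suc (ℕP.+-comm m d) ⟩
      suc d ℕ.+ m            ∎

  shiftℤ : (ℕ → ℤ) → ℕ → ℤ
  shiftℤ N zero    = ℤ.0ℤ
  shiftℤ N (suc q) = if isLast q then ℤ.0ℤ else shiftℤ N q ℤ.+ N q

  shiftℤ-cong : ∀ {N N′ : ℕ → ℤ} q → (∀ r → r ℕ.< q → N r ≡ N′ r) → shiftℤ N q ≡ shiftℤ N′ q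
  shiftℤ-cong zero    _    = refl
  shiftℤ-cong (suc q) N≗N′ with isLast q
  ... | true  = refl
  ... | false = cong₂ ℤ._+_ (shiftℤ-cong q (λ r r<q → N≗N′ r (ℕP.m<n⇒m<1+n r<q)))
                            (N≗N′ q ℕP.≤-refl)

  -- F times the corner coordinate N q − shiftℤ N q / F.
  level : (ℕ → ℤ) → ℕ → ℤ
  level N q = ℤ.+ F ℤ.* N q ℤ.- shiftℤ N q

  -- Inside a block |U| ≤ rank, so |D| ≤ 1; at a closing coordinate Δ = 0 forces D = U = 0;
  -- and going backwards, U (q + 1) = 0 gives (F + 1) U q = − Δ q, so again D q = U q = 0.
  module LevelAgreement (d : ℕ) (N N′ : ℕ → ℤ)
    (levels-close : ∀ q → q ℕ.< d → ∣ level N q ℤ.- level N′ q ∣ ℕ.≤ F)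
    (levels-agree : ∀ q → q ℕ.< d → closing d q ≡ true → level N q ≡ level N′ q) where

    D U Δ : ℕ → ℤ
    D q = N q ℤ.- N′ q
    U q = shiftℤ N q ℤ.- shiftℤ N′ q
    Δ q = level N q ℤ.- level N′ q

    F*D≡Δ+U : ∀ q → ℤ.+ F ℤ.* D q ≡ Δ q ℤ.+ U q
    F*D≡Δ+U q = ring (ℤ.+ F) (N q) (N′ q) (shiftℤ N q) (shiftℤ N′ q)
      where
      ring : ∀ f n n′ t t′ →
             f ℤ.* (n ℤ.- n′) ≡ ((f ℤ.* n ℤ.- t) ℤ.- (f ℤ.* n′ ℤ.- t′)) ℤ.+ (t ℤ.- t′)
      ring = solve-∀

    U-step : ∀ q → (shiftℤ N q ℤ.+ N q) ℤ.- (shiftℤ N′ q ℤ.+ N′ q) ≡ U q ℤ.+ D q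
    U-step q = ring (shiftℤ N q) (N q) (shiftℤ N′ q) (N′ q)
      where
      ring : ∀ t n t′ n′ → (t ℤ.+ n) ℤ.- (t′ ℤ.+ n′) ≡ (t ℤ.- t′) ℤ.+ (n ℤ.- n′)
      ring = solve-∀

    U-suc-inner : ∀ q → isLast q ≡ false → U (suc q) ≡ U q ℤ.+ D q
    U-suc-inner q eq rewrite eq = U-step q

    ∣U∣≤rank : ∀ q → q ℕ.< d → ∣ U q ∣ ℕ.≤ rank q
    ∣U∣≤rank zero    _    = z≤n
    ∣U∣≤rank (suc q) sq<d with isLast q in eq
    ... | true  = z≤n
    ... | false = subst (λ u → ∣ u ∣ ℕ.≤ suc (rank q)) (sym (U-step q)) (begin
      ∣ U q ℤ.+ D q ∣       ≤⟨ ℤP.∣i+j∣≤∣i∣+∣j∣ (U q) (D q) ⟩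
      ∣ U q ∣ ℕ.+ ∣ D q ∣   ≤⟨ ℕP.+-mono-≤ IH ∣D∣≤1 ⟩
      rank q ℕ.+ 1          ≡⟨ ℕP.+-comm (rank q) 1 ⟩
      suc (rank q)          ∎)
      where
      open ℕP.≤-Reasoning
      q<d = ℕP.<⇒≤ sq<d
      IH = ∣U∣≤rank q q<d
      ∣D∣≤1 : ∣ D q ∣ ℕ.≤ 1
      ∣D∣≤1 = ℕP.<⇒≤pred (∣n*i∣<n*k⇒∣i∣<k F (D q) 2 (begin-strict
        ∣ ℤ.+ F ℤ.* D q ∣      ≡⟨ cong ∣_∣ (F*D≡Δ+U q) ⟩
        ∣ Δ q ℤ.+ U q ∣        ≤⟨ ℤP.∣i+j∣≤∣i∣+∣j∣ (Δ q) (U q) ⟩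
        ∣ Δ q ∣ ℕ.+ ∣ U q ∣    <⟨ ℕP.+-mono-≤-< (levels-close q q<d) (ℕP.≤-<-trans IH (rank<F q)) ⟩
        F ℕ.+ F                ≡⟨ n+n≡n*2 F ⟩
        F ℕ.* 2                ∎))
        where
        n+n≡n*2 : ∀ n → n ℕ.+ n ≡ n ℕ.* 2
        n+n≡n*2 n = trans (cong (n ℕ.+_) (sym (ℕP.+-identityʳ n))) (ℕP.*-comm 2 n)

    closing⇒D≡0×U≡0 : ∀ q → q ℕ.< d → closing d q ≡ true → D q ≡ ℤ.0ℤ × U q ≡ ℤ.0ℤ
    closing⇒D≡0×U≡0 q q<d closing-q = D≡0 , U≡0
      where
      F*D≡U : ℤ.+ F ℤ.* D q ≡ U q
      F*D≡U = begin
        ℤ.+ F ℤ.* D q     ≡⟨ F*D≡Δ+U q ⟩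
        Δ q ℤ.+ U q       ≡⟨ cong (ℤ._+ U q) (ℤP.i≡j⇒i-j≡0 (levels-agree q q<d closing-q)) ⟩
        ℤ.0ℤ ℤ.+ U q      ≡⟨ ℤP.+-identityˡ (U q) ⟩
        U q               ∎
        where open ≡-Reasoning
      D≡0 : D q ≡ ℤ.0ℤ
      D≡0 = ∣n*i∣<n⇒i≡0 F (D q)
        (subst (λ u → ∣ u ∣ ℕ.< F) (sym F*D≡U) (ℕP.≤-<-trans (∣U∣≤rank q q<d) (rank<F q)))
      U≡0 : U q ≡ ℤ.0ℤ
      U≡0 = trans (sym F*D≡U) (trans (cong (ℤ.+ F ℤ.*_) D≡0) (ℤP.*-zeroʳ (ℤ.+ F)))

    U-suc≡0⇒D≡0×U≡0 : ∀ q → q ℕ.< d → isLast q ≡ false → U (suc q) ≡ ℤ.0ℤ →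
                      D q ≡ ℤ.0ℤ × U q ≡ ℤ.0ℤ
    U-suc≡0⇒D≡0×U≡0 q q<d inner U-suc≡0 = D≡0 , U≡0
      where
      U+D≡0 : U q ℤ.+ D q ≡ ℤ.0ℤ
      U+D≡0 = trans (sym (U-suc-inner q inner)) U-suc≡0
      [1+F]*U≡-Δ : ℤ.+ suc F ℤ.* U q ≡ ℤ.- Δ q
      [1+F]*U≡-Δ = begin
        ℤ.+ suc F ℤ.* U q
          ≡⟨ expand (ℤ.+ F) (U q) (D q) ⟩
        ℤ.+ F ℤ.* (U q ℤ.+ D q) ℤ.- ℤ.+ F ℤ.* D q ℤ.+ U q
          ≡⟨ cong₂ (λ a b → ℤ.+ F ℤ.* a ℤ.- b ℤ.+ U q) U+D≡0 (F*D≡Δ+U q) ⟩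
        ℤ.+ F ℤ.* ℤ.0ℤ ℤ.- (Δ q ℤ.+ U q) ℤ.+ U q
          ≡⟨ collapse (ℤ.+ F) (Δ q) (U q) ⟩
        ℤ.- Δ q
          ∎
        where
        open ≡-Reasoning
        expand : ∀ f u v → (ℤ.1ℤ ℤ.+ f) ℤ.* u ≡ f ℤ.* (u ℤ.+ v) ℤ.- f ℤ.* v ℤ.+ u
        expand = solve-∀
        collapse : ∀ f δ u → f ℤ.* ℤ.0ℤ ℤ.- (δ ℤ.+ u) ℤ.+ u ≡ ℤ.- δ
        collapse = solve-∀
      U≡0 : U q ≡ ℤ.0ℤ
      U≡0 = ∣n*i∣<n⇒i≡0 (suc F) (U q)
        (subst (ℕ._< suc F) (sym (trans (cong ∣_∣ [1+F]*U≡-Δ) (ℤP.∣-i∣≡∣i∣ (Δ q))))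
               (s≤s (levels-close q q<d)))
      D≡0 : D q ≡ ℤ.0ℤ
      D≡0 = trans (sym (ℤP.+-identityˡ (D q))) (trans (cong (ℤ._+ D q) (sym U≡0)) U+D≡0)

    D≡0×U≡0 : ∀ k q → suc q ℕ.+ k ≡ d → D q ≡ ℤ.0ℤ × U q ≡ ℤ.0ℤ
    D≡0×U≡0 zero q sq+0≡d =
      closing⇒D≡0×U≡0 q (ℕP.≤-reflexive sq≡d) (subst (λ d → closing d q ≡ true) sq≡d (closing-last q))
      where
      sq≡d : suc q ≡ d
      sq≡d = trans (sym (ℕP.+-identityʳ (suc q))) sq+0≡d
    D≡0×U≡0 (suc k) q sq+sk≡d with isLast q in eq
    ... | true  = closing⇒D≡0×U≡0 q (ℕP.m+n≤o⇒m≤o (suc q) (ℕP.≤-reflexive sq+sk≡d))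
                    (cong (_∨ (suc q ℕ.≡ᵇ d)) eq)
    ... | false = U-suc≡0⇒D≡0×U≡0 q (ℕP.m+n≤o⇒m≤o (suc q) (ℕP.≤-reflexive sq+sk≡d)) eq
                    (proj₂ (D≡0×U≡0 k (suc q) (trans (sym (ℕP.+-suc (suc q) k)) sq+sk≡d)))

  levelAgreement⇒≡ : ∀ d (N N′ : ℕ → ℤ) →
    (∀ q → q ℕ.< d → ∣ level N q ℤ.- level N′ q ∣ ℕ.≤ F) →
    (∀ q → q ℕ.< d → closing d q ≡ true → level N q ≡ level N′ q) →
    ∀ q → q ℕ.< d → N q ≡ N′ q
  levelAgreement⇒≡ d N N′ levels-close levels-agree q q<d =
    ℤP.i-j≡0⇒i≡j (N q) (N′ q) (proj₁ (D≡0×U≡0 (d ℕ.∸ suc q) q (ℕP.m+[n∸m]≡n q<d)))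
    where open LevelAgreement d N N′ levels-close levels-agree

  Digits : ℕ → (ℕ → ℕ) → Set
  Digits n c = ∀ q → q ℕ.< n → c q ℕ.≤ F

  Digits-pred : ∀ {n c} → Digits (suc n) c → Digits n c
  Digits-pred c≤F q q<n = c≤F q (ℕP.m<n⇒m<1+n q<n)

  encode : ℕ → (ℕ → ℕ) → ℕ → ℕ
  encode d c zero    = zero
  encode d c (suc q) = if closing d q then c q ℕ.+ encode d c q ℕ.* suc F else encode d c q

  encode< : ∀ d c n → Digits n c → encode d c n ℕ.< suc F ^ #closing d n
  encode< d c zero    c≤F = s≤s z≤n
  encode< d c (suc n) c≤F with closing d n
  ... | false = encode< d c n (Digits-pred c≤F)
  ... | true  = begin-strict
    c n ℕ.+ encode d c n ℕ.* suc F    <⟨ ℕP.+-monoˡ-< _ (s≤s (c≤F n ℕP.≤-refl)) ⟩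
    suc F ℕ.+ encode d c n ℕ.* suc F  ≡⟨ ℕP.*-comm (suc (encode d c n)) (suc F) ⟩
    suc F ℕ.* suc (encode d c n)      ≤⟨ ℕP.*-monoʳ-≤ (suc F) (encode< d c n (Digits-pred c≤F)) ⟩
    suc F ℕ.* suc F ^ #closing d n    ∎
    where open ℕP.≤-Reasoning

  encode-injective : ∀ d c c′ n → Digits n c → Digits n c′ →
    encode d c n ≡ encode d c′ n → ∀ q → q ℕ.< n → closing d q ≡ true → c q ≡ c′ q
  encode-injective d c c′ (suc n) c≤F c′≤F e q q<1+n closing-q
    with closing d n in eq | ℕP.m<1+n⇒m<n∨m≡n q<1+n
  ... | true  | inj₂ refl = proj₁ (digits-unique (suc F) {b = encode d c n} {b′ = encode d c′ n}
                                    (s≤s (c≤F n ℕP.≤-refl)) (s≤s (c′≤F n ℕP.≤-refl)) e)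
  ... | true  | inj₁ q<n  = encode-injective d c c′ n (Digits-pred c≤F) (Digits-pred c′≤F)
                              (proj₂ (digits-unique (suc F) (s≤s (c≤F n ℕP.≤-refl))
                                                            (s≤s (c′≤F n ℕP.≤-refl)) e))
                              q q<n closing-q
  ... | false | inj₁ q<n  = encode-injective d c c′ n (Digits-pred c≤F) (Digits-pred c′≤F) e q q<n closing-q
  ... | false | inj₂ refl = ⊥-elim (subst T (trans (sym closing-q) eq) _)

All-lookup : ∀ {A : Set} {P : A → Set} {xs : List A} → All P xs → (i : Fin (length xs)) → P (lookup xs i)
All-lookup (px ∷ _)   Fin.zero    = px
All-lookup (_  ∷ pxs) (Fin.suc i) = All-lookup pxs i

AllPairs-lookup : ∀ {A : Set} {R : A → A → Set} {xs : List A} → AllPairs R xs →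
                  ∀ {i j} → i Fin.< j → R (lookup xs i) (lookup xs j)
AllPairs-lookup (Rx ∷ _)   {Fin.zero}  {Fin.suc j} _         = All-lookup Rx j
AllPairs-lookup (_  ∷ Rxs) {Fin.suc i} {Fin.suc j} (s≤s i<j) = AllPairs-lookup Rxs i<j

length≤-byCode : ∀ {A : Set} {P : A → Set} {R : A → A → Set} k (code : ∀ {a} → P a → Fin k) →
  (∀ {a b} (pa : P a) (pb : P b) → code pa ≡ code pb → ¬ R a b) →
  ∀ {xs} → All P xs → AllPairs R xs → length xs ℕ.≤ k
length≤-byCode k code code-separates {xs} pxs Rxs with length xs ℕ.≤? k
... | yes xs≤k = xs≤k
... | no  xs≰k with FinP.pigeonhole (ℕP.≰⇒> xs≰k) (λ i → code (All-lookup pxs i))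
...   | (i , j , i<j , same-code) =
  ⊥-elim (code-separates (All-lookup pxs i) (All-lookup pxs j) same-code (AllPairs-lookup Rxs i<j))

¬¬-choice : ∀ {Q : ℕ → ℤ → Set} n → (∀ q → q ℕ.< n → ¬ ¬ ∃ (Q q)) →
            ¬ ¬ (∃ λ (G : ℕ → ℤ) → ∀ q → q ℕ.< n → Q q (G q))
¬¬-choice zero    _      = pure ((λ _ → ℤ.0ℤ) , λ _ ())
  where open RawMonad (¬¬-Monad {a = 0ℓ})
¬¬-choice {Q} (suc n) chosen = do
  (G , QG) ← ¬¬-choice n (λ q q<n → chosen q (ℕP.m<n⇒m<1+n q<n))
  (k , Qk) ← chosen n ℕP.≤-refl
  pure (extend G k , extend-correct G QG k Qk)
  where
  open RawMonad (¬¬-Monad {a = 0ℓ})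
  extend : (ℕ → ℤ) → ℤ → ℕ → ℤ
  extend G k q with q ℕ.≟ n
  ... | yes _ = k
  ... | no  _ = G q
  extend-correct : ∀ G → (∀ q → q ℕ.< n → Q q (G q)) → ∀ k → Q n k →
                   ∀ q → q ℕ.< suc n → Q q (extend G k q)
  extend-correct G QG k Qk q q<1+n with q ℕ.≟ n
  ... | yes refl = Qk
  ... | no  q≢n  = QG q (ℕP.≤∧≢⇒< (ℕP.≤-pred q<1+n) q≢n)

toSeq : ∀ {A : Set} {d} → A → (Fin d → A) → ℕ → A
toSeq {d = zero}  a₀ x p       = a₀
toSeq {d = suc d} a₀ x zero    = x Fin.zero
toSeq {d = suc d} a₀ x (suc p) = toSeq a₀ (λ i → x (Fin.suc i)) p

toSeq-toℕ : ∀ {A : Set} {d} (a₀ : A) (x : Fin d → A) i → toSeq a₀ x (Fin.toℕ i) ≡ x i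
toSeq-toℕ a₀ x Fin.zero    = refl
toSeq-toℕ a₀ x (Fin.suc i) = toSeq-toℕ a₀ (λ j → x (Fin.suc j)) i

∀Fin⇒∀< : ∀ {d} (P : ℕ → Set) → (∀ (i : Fin d) → P (Fin.toℕ i)) → ∀ p → p ℕ.< d → P p
∀Fin⇒∀< P P-toℕ p p<d = subst P (FinP.toℕ-fromℕ< p<d) (P-toℕ (Fin.fromℕ< p<d))

module Staircase (ℝ : RealField) (m : ℕ) (w : RealField.R ℝ) where
  open RealField ℝ
  open RealFieldProperties ℝ
  open Floor ℝ
  open Blocks m

  shift : (ℕ → R) → ℕ → R
  shift X zero    = 0r
  shift X (suc p) = if isLast p then 0r else shift X p + floor (X p + shift X p * w)

  cornerAt : (ℕ → R) → ℕ → R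
  cornerAt X p = floor (X p + shift X p * w) - shift X p * w

  corner : ∀ {d} → Point ℝ d → Point ℝ d
  corner x i = cornerAt (toSeq 0r x) (Fin.toℕ i)

  IsCorner : ∀ {d} → Point ℝ d → Set
  IsCorner {d} a = ∃ λ (y : Point ℝ d) → ∀ i → a i ≡ corner y i

  floor-shifted-cell : ∀ x y t → InUnitInterval (floor y - t) x → floor (x + t) ≡ floor y
  floor-shifted-cell x y t x∈ =
    floor-cell (subst (λ a → InUnitInterval a (x + t)) (x-y+y≡x (floor y) t) (InUnitInterval-+ t x∈))

  cornerAt-cube : ∀ X p → InUnitInterval (cornerAt X p) (X p)
  cornerAt-cube X p = subst (InUnitInterval (cornerAt X p)) (x+y-y≡x (X p) t)
    (InUnitInterval-+ (- t) (floor-≤ (X p + t) , <-floor+1 (X p + t)))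
    where t = shift X p * w

  corner-cube : ∀ {d} (x : Point ℝ d) → InCube ℝ (corner x) x
  corner-cube x i = subst (InUnitInterval (corner x i)) (toSeq-toℕ 0r x i) (cornerAt-cube (toSeq 0r x) (Fin.toℕ i))

  InCube-cong : ∀ {d} {a b x : Point ℝ d} → (∀ i → a i ≡ b i) → InCube ℝ a x → InCube ℝ b x
  InCube-cong {x = x} a≗b x∈a i = subst (λ u → InUnitInterval u (x i)) (a≗b i) (x∈a i)

  module _ {d} (x y : Point ℝ d) (x∈y : InCube ℝ (corner y) x) where
    private
      X Y : ℕ → R
      X = toSeq 0r x
      Y = toSeq 0r y

      cube-at : ∀ p → p ℕ.< d → InUnitInterval (cornerAt Y p) (X p)
      cube-at = ∀Fin⇒∀< (λ q → InUnitInterval (cornerAt Y q) (X q))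
        λ i → subst (InUnitInterval (corner y i)) (sym (toSeq-toℕ 0r x i)) (x∈y i)

      floor-step : ∀ p → p ℕ.< d → shift Y p ≡ shift X p →
                   floor (Y p + shift Y p * w) ≡ floor (X p + shift X p * w)
      floor-step p p<d shifts≡ = begin
        floor (Y p + shift Y p * w)  ≡⟨ cong (λ s → floor (Y p + s * w)) shifts≡ ⟩
        floor (Y p + shift X p * w)  ≡⟨ floor-shifted-cell (X p) _ _ X∈ ⟨
        floor (X p + shift X p * w)  ∎
        where
        open ≡-Reasoning
        X∈ = subst (λ s → InUnitInterval (floor (Y p + s * w) - s * w) (X p)) shifts≡ (cube-at p p<d)

      shift≡ : ∀ p → p ℕ.≤ d → shift Y p ≡ shift X p
      shift≡ zero    _    = refl
      shift≡ (suc p) sp≤d with isLast p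
      ... | true  = refl
      ... | false = cong₂ _+_ IH (floor-step p sp≤d IH)
        where IH = shift≡ p (ℕP.<⇒≤ sp≤d)

    corner-unique : ∀ i → corner y i ≡ corner x i
    corner-unique i = cong₂ (λ f s → f - s * w) (floor-step p p<d shifts≡) shifts≡
      where
      p = Fin.toℕ i
      p<d = FinP.toℕ<n i
      shifts≡ = shift≡ p (ℕP.<⇒≤ p<d)

  isUnitCubePartition : ∀ {d} → IsUnitCubePartition ℝ (IsCorner {d})
  isUnitCubePartition = (λ x → corner x , (x , λ _ → refl) , corner-cube x) ,
    λ x a b (y , a≗y) (y′ , b≗y′) x∈a x∈b i → begin
      a i           ≡⟨ a≗y i ⟩
      corner y i    ≡⟨ corner-unique x y (InCube-cong a≗y x∈a) i ⟩
      corner x i    ≡⟨ sym (corner-unique x y′ (InCube-cong b≗y′ x∈b) i) ⟩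
      corner y′ i   ≡⟨ sym (b≗y′ i) ⟩
      b i           ∎
    where open ≡-Reasoning

module Seclusion (ℝ : RealField) (m : ℕ) (ε : RealField.R ℝ)
                 (2εF≡1 : RealField._*_ ℝ ε (RealField.fromℕ ℝ (2 ℕ.* suc m)) ≡ RealField.1r ℝ) where
  open RealField ℝ
  open RealFieldProperties ℝ
  open Floor ℝ
  open Blocks m

  w : R
  w = ε + ε

  open Staircase ℝ m w

  Fᵣ : R
  Fᵣ = fromℕ F

  h : R
  h = ε * Fᵣ

  h+h≡1 : h + h ≡ 1r
  h+h≡1 = begin
    ε * Fᵣ + ε * Fᵣ      ≡⟨ sym (distrib ε Fᵣ Fᵣ) ⟩
    ε * (Fᵣ + Fᵣ)        ≡⟨ cong (λ n → ε * (Fᵣ + fromℕ n)) (sym (ℕP.+-identityʳ F)) ⟩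
    ε * (Fᵣ + fromℕ (F ℕ.+ 0)) ≡⟨ cong (ε *_) (sym (fromℕ-+ F (F ℕ.+ 0))) ⟩
    ε * fromℕ (2 ℕ.* F)  ≡⟨ 2εF≡1 ⟩
    1r                   ∎
    where open ≡-Reasoning

  w*F≡1 : w * Fᵣ ≡ 1r
  w*F≡1 = trans (distribʳ Fᵣ ε ε) h+h≡1

  0<Fᵣ : 0r < Fᵣ
  0<Fᵣ = 0≤fromℕ F , λ 0≡F → 0≢1 (trans (sym (zeroʳ w)) (trans (cong (w *_) 0≡F) w*F≡1))

  module _ {d} (p : Point ℝ d) where
    private
      P : ℕ → R
      P = toSeq 0r p

    IntegralCorner : Point ℝ d → Set
    IntegralCorner a = ∃ λ (y : Point ℝ d) → (∀ i → a i ≡ corner y i) ×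
      ∃ λ (N : ℕ → ℤ) → ∀ q → q ℕ.< d → floor (toSeq 0r y q + shift (toSeq 0r y) q * w) ≡ fromℤ (N q)

    integralCorner : ∀ {a} → IsCorner a → ¬ ¬ IntegralCorner a
    integralCorner (y , a≗y) = do
      (N , N-floor) ← ¬¬-choice d (λ q _ → floor-integral (toSeq 0r y q + shift (toSeq 0r y) q * w))
      pure (y , a≗y , N , N-floor)
      where open RawMonad (¬¬-Monad {a = 0ℓ})

    module Levels (G : ℕ → ℤ) (G-floor : ∀ q → q ℕ.< d → IsIntegerFloor (Fᵣ * P q + h) (G q))
                  {a : Point ℝ d} (ic : IntegralCorner a) (meets : BallMeetsCube ℝ ε p a) where
      private
        y = proj₁ ic
        a≗y = proj₁ (proj₂ ic)
        Y = toSeq 0r y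
      N : ℕ → ℤ
      N = proj₁ (proj₂ (proj₂ ic))
      private
        N-floor = proj₂ (proj₂ (proj₂ ic))

      shift≡ : ∀ q → q ℕ.≤ d → shift Y q ≡ fromℤ (shiftℤ N q)
      shift≡ zero    _    = refl
      shift≡ (suc q) sq≤d with isLast q
      ... | true  = refl
      ... | false = trans (cong₂ _+_ (shift≡ q (ℕP.<⇒≤ sq≤d)) (N-floor q sq≤d))
                          (sym (fromℤ-+ (shiftℤ N q) (N q)))

      cornerAt≡ : ∀ q → q ℕ.< d → cornerAt Y q ≡ fromℤ (N q) - fromℤ (shiftℤ N q) * w
      cornerAt≡ q q<d = cong₂ (λ f s → f - s * w) (N-floor q q<d) (shift≡ q (ℕP.<⇒≤ q<d))

      a≡ : ∀ i → a i ≡ fromℤ (N (Fin.toℕ i)) - fromℤ (shiftℤ N (Fin.toℕ i)) * w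
      a≡ i = trans (a≗y i) (cornerAt≡ (Fin.toℕ i) (FinP.toℕ<n i))

      F*cornerAt≡level : ∀ q → q ℕ.< d → Fᵣ * cornerAt Y q ≡ fromℤ (level N q)
      F*cornerAt≡level q q<d = begin
        Fᵣ * cornerAt Y q     ≡⟨ cong (Fᵣ *_) (cornerAt≡ q q<d) ⟩
        Fᵣ * (n - t * w)        ≡⟨ ring Fᵣ n t w ⟩
        Fᵣ * n - t * (w * Fᵣ)   ≡⟨ cong (λ u → Fᵣ * n - t * u) w*F≡1 ⟩
        Fᵣ * n - t * 1r         ≡⟨ cong (λ u → Fᵣ * n - u) (*-identity t) ⟩
        Fᵣ * n - t              ≡⟨ cong₂ _+_ (fromℤ-* (ℤ.+ F) (N q)) (fromℤ-neg (shiftℤ N q)) ⟨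
        fromℤ (ℤ.+ F ℤ.* N q) + fromℤ (ℤ.- shiftℤ N q)
                                ≡⟨ fromℤ-+ (ℤ.+ F ℤ.* N q) (ℤ.- shiftℤ N q) ⟨
        fromℤ (level N q)       ∎
        where
        open ≡-Reasoning
        n = fromℤ (N q)
        t = fromℤ (shiftℤ N q)
        ring : ∀ F n t w → F * (n - t * w) ≡ F * n - t * (w * F)
        ring = Solver.solve 4 (λ F n t w → F :* (n :- t :* w) := F :* n :- t :* (w :* F)) refl
          where open Solver

      cornerAt-near : ∀ q → q ℕ.< d → cornerAt Y q ≤ P q + ε × P q - ε < cornerAt Y q + 1r
      cornerAt-near = ∀Fin⇒∀< (λ q → cornerAt Y q ≤ P q + ε × P q - ε < cornerAt Y q + 1r) λ i →
        let (x , x∈a , x-near) = meets in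
        subst₂ (λ c u → c ≤ u + ε × u - ε < c + 1r) (a≗y i) (sym (toSeq-toℕ 0r p i))
          (≤-trans (proj₁ (x∈a i)) (proj₂ (x-near i)) , ≤-<-trans (proj₁ (x-near i)) (proj₂ (x∈a i)))

      F*[u+ε]≡F*u+h : ∀ u → Fᵣ * (u + ε) ≡ Fᵣ * u + h
      F*[u+ε]≡F*u+h u = trans (distrib Fᵣ u ε) (cong (Fᵣ * u +_) (*-comm Fᵣ ε))

      level≤G : ∀ q → q ℕ.< d → level N q ℤ.≤ G q
      level≤G q q<d = subst (level N q ℤ.≤_) (ℤP.pred-suc (G q))
        (ℤP.i<j⇒i≤pred[j] (fromℤ-cancel-< {j = ℤ.suc (G q)} level<1+G))
        where
        open ≤-Reasoning
        level<1+G : fromℤ (level N q) < fromℤ (ℤ.suc (G q))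
        level<1+G = begin-strict
          fromℤ (level N q)      ≡⟨ F*cornerAt≡level q q<d ⟨
          Fᵣ * cornerAt Y q      ≤⟨ *-monoˡ-≤-nonNeg Fᵣ (proj₁ 0<Fᵣ) (proj₁ (cornerAt-near q q<d)) ⟩
          Fᵣ * (P q + ε)         ≡⟨ F*[u+ε]≡F*u+h (P q) ⟩
          Fᵣ * P q + h           <⟨ proj₂ (G-floor q q<d) ⟩
          fromℤ (G q) + 1r       ≡⟨ fromℤ-suc (G q) ⟨
          fromℤ (ℤ.suc (G q))    ∎

      G≤level+F : ∀ q → q ℕ.< d → G q ℤ.≤ level N q ℤ.+ ℤ.+ F
      G≤level+F q q<d = subst (ℤ._≤ _) (ℤP.suc-pred (G q))
        (ℤP.i<j⇒suc[i]≤j (fromℤ-cancel-< {i = ℤ.pred (G q)} G-1<level+F))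
        where
        open ≤-Reasoning
        open Solver using (_:+_; _:-_; _:*_; _:=_)
        G-1<level+F : fromℤ (ℤ.pred (G q)) < fromℤ (level N q ℤ.+ ℤ.+ F)
        G-1<level+F = begin-strict
          fromℤ (ℤ.pred (G q))          ≡⟨ fromℤ-pred (G q) ⟩
          fromℤ (G q) - 1r              ≤⟨ +-mono-≤ (- 1r) (proj₁ (G-floor q q<d)) ⟩
          (Fᵣ * P q + h) - 1r           ≡⟨ cong (λ u → (Fᵣ * P q + h) - u) (sym h+h≡1) ⟩
          (Fᵣ * P q + h) - (h + h)      ≡⟨ Solver.solve 3 (λ F u e → (F :* u :+ e :* F) :- (e :* F :+ e :* F)
                                                                  := F :* (u :- e)) refl Fᵣ (P q) ε ⟩
          Fᵣ * (P q - ε)                <⟨ *-monoˡ-<-pos Fᵣ 0<Fᵣ (proj₂ (cornerAt-near q q<d)) ⟩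
          Fᵣ * (cornerAt Y q + 1r)
                                        ≡⟨ trans (distrib Fᵣ _ 1r) (cong (Fᵣ * cornerAt Y q +_) (*-identity Fᵣ)) ⟩
          Fᵣ * cornerAt Y q + Fᵣ        ≡⟨ cong (_+ Fᵣ) (F*cornerAt≡level q q<d) ⟩
          fromℤ (level N q) + Fᵣ        ≡⟨ fromℤ-+ (level N q) (ℤ.+ F) ⟨
          fromℤ (level N q ℤ.+ ℤ.+ F)   ∎

      digit : ℕ → ℕ
      digit q = ∣ level N q ℤ.+ ℤ.+ F ℤ.- G q ∣

      +digit≡ : ∀ q → q ℕ.< d → ℤ.+ digit q ≡ level N q ℤ.+ ℤ.+ F ℤ.- G q
      +digit≡ q q<d = ℤP.0≤i⇒+∣i∣≡i (ℤP.i≤j⇒0≤j-i (G≤level+F q q<d))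

      digits : Digits d digit
      digits q q<d = ℤP.drop‿+≤+ (begin
        ℤ.+ digit q                          ≡⟨ +digit≡ q q<d ⟩
        level N q ℤ.+ ℤ.+ F ℤ.- G q          ≤⟨ ℤP.+-monoˡ-≤ _ (ℤP.+-monoˡ-≤ _ (level≤G q q<d)) ⟩
        G q ℤ.+ ℤ.+ F ℤ.- G q                ≡⟨ ring (G q) (ℤ.+ F) ⟩
        ℤ.+ F                                ∎)
        where
        open ℤP.≤-Reasoning
        ring : ∀ g f → g ℤ.+ f ℤ.- g ≡ f
        ring = solve-∀

    module _ (G : ℕ → ℤ) (G-floor : ∀ q → q ℕ.< d → IsIntegerFloor (Fᵣ * P q + h) (G q)) where

      MeetingCorner : Point ℝ d → Set
      MeetingCorner a = IntegralCorner a × BallMeetsCube ℝ ε p a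

      code : ∀ {a} → MeetingCorner a → ℕ
      code (ic , meets) = encode d (Levels.digit G G-floor ic meets) d

      code< : ∀ {a} (A : MeetingCorner a) → code A ℕ.< suc F ^ ceilDiv d F
      code< (ic , meets) = ℕP.<-≤-trans (encode< d _ d (Levels.digits G G-floor ic meets))
                                        (ℕP.^-monoʳ-≤ (suc F) (#closing≤ceilDiv d))

      module _ {a b} (A : MeetingCorner a) (B : MeetingCorner b) where
        private
          module A = Levels G G-floor (proj₁ A) (proj₂ A)
          module B = Levels G G-floor (proj₁ B) (proj₂ B)

        levels-close : ∀ q → q ℕ.< d → ∣ level A.N q ℤ.- level B.N q ∣ ℕ.≤ F
        levels-close q q<d = subst (λ u → ∣ u ∣ ℕ.≤ F) (sym ΔL≡digit⊖digit)
          (ℕP.≤-trans (ℤP.∣m⊝n∣≤m⊔n (A.digit q) (B.digit q)) (ℕP.⊔-lub (A.digits q q<d) (B.digits q q<d)))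
          where
          open ≡-Reasoning
          ring : ∀ x y f g → x ℤ.- y ≡ (x ℤ.+ f ℤ.- g) ℤ.- (y ℤ.+ f ℤ.- g)
          ring = solve-∀
          ΔL≡digit⊖digit : level A.N q ℤ.- level B.N q ≡ A.digit q ℤ.⊖ B.digit q
          ΔL≡digit⊖digit = begin
            level A.N q ℤ.- level B.N q
              ≡⟨ ring (level A.N q) (level B.N q) (ℤ.+ F) (G q) ⟩
            (level A.N q ℤ.+ ℤ.+ F ℤ.- G q) ℤ.- (level B.N q ℤ.+ ℤ.+ F ℤ.- G q)
              ≡⟨ cong₂ ℤ._-_ (A.+digit≡ q q<d) (B.+digit≡ q q<d) ⟨
            ℤ.+ A.digit q ℤ.- ℤ.+ B.digit q
              ≡⟨ ℤP.m-n≡m⊖n (A.digit q) (B.digit q) ⟩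
            A.digit q ℤ.⊖ B.digit q
              ∎

        same-code⇒levels-agree : code A ≡ code B →
          ∀ q → q ℕ.< d → closing d q ≡ true → level A.N q ≡ level B.N q
        same-code⇒levels-agree same-code q q<d closing-q = begin
          level A.N q                                          ≡⟨ ring (level A.N q) (ℤ.+ F) (G q) ⟩
          (level A.N q ℤ.+ ℤ.+ F ℤ.- G q) ℤ.- (ℤ.+ F ℤ.- G q)  ≡⟨ cong (ℤ._- _) shifted-levels≡ ⟩
          (level B.N q ℤ.+ ℤ.+ F ℤ.- G q) ℤ.- (ℤ.+ F ℤ.- G q)  ≡⟨ ring (level B.N q) (ℤ.+ F) (G q) ⟨
          level B.N q                                          ∎
          where
          open ≡-Reasoning
          ring : ∀ x f g → x ≡ (x ℤ.+ f ℤ.- g) ℤ.- (f ℤ.- g)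
          ring = solve-∀
          digit≡ : A.digit q ≡ B.digit q
          digit≡ = encode-injective d A.digit B.digit d A.digits B.digits same-code q q<d closing-q
          shifted-levels≡ : level A.N q ℤ.+ ℤ.+ F ℤ.- G q ≡ level B.N q ℤ.+ ℤ.+ F ℤ.- G q
          shifted-levels≡ = trans (sym (A.+digit≡ q q<d)) (trans (cong ℤ.+_ digit≡) (B.+digit≡ q q<d))

        code-injective : code A ≡ code B → ∀ i → a i ≡ b i
        code-injective same-code i = begin
          a i                                       ≡⟨ A.a≡ i ⟩
          fromℤ (A.N q) - fromℤ (shiftℤ A.N q) * w
            ≡⟨ cong₂ (λ n t → fromℤ n - fromℤ t * w) (N≡ q q<d) shiftℤ≡ ⟩
          fromℤ (B.N q) - fromℤ (shiftℤ B.N q) * w  ≡⟨ B.a≡ i ⟨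
          b i                                       ∎
          where
          open ≡-Reasoning
          q = Fin.toℕ i
          q<d = FinP.toℕ<n i
          N≡ : ∀ q → q ℕ.< d → A.N q ≡ B.N q
          N≡ = levelAgreement⇒≡ d A.N B.N levels-close (same-code⇒levels-agree same-code)
          shiftℤ≡ = shiftℤ-cong q (λ r r<q → N≡ r (ℕP.<-trans r<q q<d))

  secluded : ∀ {d} → Secluded ℝ (suc F ^ ceilDiv d F) ε (IsCorner {d})
  secluded {d} p L corners meets distinct = decidable-stable (length L ℕ.≤? K) do
    (G , G-floor) ← ¬¬-choice d (λ q _ → integerFloor (Fᵣ * toSeq 0r p q + h))
    ics ← All.mapM 0ℓ ¬¬-Monad (integralCorner p) corners
    pure (length≤-byCode K (λ A → Fin.fromℕ< (code< p G G-floor A)) (separates G G-floor)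
                         (All.zip (ics , meets)) distinct)
    where
    open RawMonad (¬¬-Monad {a = 0ℓ})
    K = suc F ^ ceilDiv d F
    separates : ∀ G G-floor {a b} (A : MeetingCorner p G G-floor a) (B : MeetingCorner p G G-floor b) →
                Fin.fromℕ< (code< p G G-floor A) ≡ Fin.fromℕ< (code< p G G-floor B) → ¬ DistinctCube ℝ a b
    separates G G-floor A B same distinct =
      distinct (code-injective p G G-floor A B (FinP.fromℕ<-injective _ _ _ _ same))

open import Data.Nat using (_*_; _+_)

mainTheorem5 : (ℝ : RealField) → (f : ℕ → ℕ) → (d : ℕ) → f d ≢ 0 →
  (ε : RealField.R ℝ) → RealField._*_ ℝ ε (RealField.fromℕ ℝ (2 * f d)) ≡ RealField.1r ℝ →
  ∃ λ (C : Point ℝ d → Set) → IsUnitCubePartition ℝ C ×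
    Secluded ℝ ((f d + 1) ^ ceilDiv d (f d)) ε C
mainTheorem5 ℝ f d f≢0 ε 2εF≡1 with f d
... | zero  = ⊥-elim (f≢0 refl)
... | suc m = IsCorner {d} , isUnitCubePartition ,
  subst (λ k → Secluded ℝ (k ^ ceilDiv d (suc m)) ε (IsCorner {d})) (ℕP.+-comm 1 (suc m)) (secluded {d})
  where
  open Seclusion ℝ m ε 2εF≡1
  open Staircase ℝ m w
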